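{- Let $S_1$ and $S_2$ be two disjoint sets of cells of an $n\times n$ array, each of which forms a Hamilton cycle. Then the $4n$ cells of $S_1\cup S_2$ can be filled with the elements of $\{1,2,\dots,4n\}$ (each used once) so that the sum of the entries in each row and in each column is equal to $8n+2$.
   Context: Identify the cells of an $n\times n$ array with the edges of the complete bipartite graph $K_{n,n}$ with parts $\{a_1,\dots,a_n\}$ and $\{b_1,\dots,b_n\}$, cell $(i,j)$ corresponding to the edge $\{a_i,b_j\}$. A set of cells forms a Hamilton cycle if the corresponding edge set is a single cycle of length $2n$. -}

module Defs where

open import Data.Nat using (ℕ; zero; suc; _+_; _*_; _≤_; _<_)
open import Data.Fin using (Fin; toℕ)
open import Data.Fin.Properties using ()
open import Data.Bool using (Bool; true; false; _∨_; _∧_; if_then_else_)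
open import Data.Product using (Σ; ∃; _×_; _,_)
open import Data.Sum using (_⊎_)
open import Relation.Binary.PropositionalEquality using (_≡_)
open import Function.Definitions using (Injective)
open import Data.Vec.Functional using (foldr)

-- A set of cells of the n×n array: cell (i , j) belongs to S iff S i j ≡ true.
-- Cell (i , j) is the edge {a_i , b_j} of K_{n,n}.
Cells : ℕ → Set
Cells n = Fin n → Fin n → Bool

sucMod : ∀ {n} → Fin n → Fin n
sucMod {suc n} i = Data.Fin.fromℕ< {suc (toℕ i) Data.Nat.% suc n} (Data.Nat.DivMod.m%n<n (suc (toℕ i)) (suc n))
  where import Data.Nat
        import Data.Nat.DivMod

-- S forms a Hamilton cycle of K_{n,n}: there are orderings α, β of the two
-- vertex classes (injective, hence bijective, maps Fin n → Fin n) such that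
-- the edge set of S is exactly the edge set of the closed walk
--   a_{α 0} b_{β 0} a_{α 1} b_{β 1} … a_{α (n-1)} b_{β (n-1)} a_{α 0},
-- i.e. S = { (α k , β k) , (α (k+1 mod n) , β k) : k < n }.
-- n ≥ 2 is required for this to be a cycle (of length 2n ≥ 4) in a simple graph.
IsHamiltonCycle : ∀ {n} → Cells n → Set
IsHamiltonCycle {n} S =
  2 ≤ n ×
  Σ (Fin n → Fin n) λ α → Σ (Fin n → Fin n) λ β →
    Injective _≡_ _≡_ α × Injective _≡_ _≡_ β ×
    (∀ i j → S i j ≡ true →
       ∃ λ k → (i ≡ α k × j ≡ β k) ⊎ (i ≡ α (sucMod k) × j ≡ β k)) ×
    (∀ k → S (α k) (β k) ≡ true × S (α (sucMod k)) (β k) ≡ true)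

Disjoint : ∀ {n} → Cells n → Cells n → Set
Disjoint {n} S T = ∀ i j → S i j ≡ true → T i j ≡ false

Union : ∀ {n} → Cells n → Cells n → Cells n
Union S T i j = S i j ∨ T i j

sumFin : ∀ {n} → (Fin n → ℕ) → ℕ
sumFin f = foldr _+_ 0 f

entry : ∀ {n} → Cells n → (Fin n → Fin n → ℕ) → Fin n → Fin n → ℕ
entry U L i j = if U i j then L i j else 0

IsFilling : ∀ {n} → ℕ → Cells n → (Fin n → Fin n → ℕ) → Set
IsFilling {n} m U L =
  (∀ i j → U i j ≡ true → 1 ≤ L i j × L i j ≤ m) ×
  (∀ i j i' j' → U i j ≡ true → U i' j' ≡ true → L i j ≡ L i' j' → i ≡ i' × j ≡ j') ×
  (∀ v → 1 ≤ v → v ≤ m → ∃ λ i → ∃ λ j → U i j ≡ true × L i j ≡ v)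

-- Traverse each cycle as a_{α 0} b_{β 0} a_{α 1} b_{β 1} …, so that its cells are the even
-- cells (α k , β k) and the odd cells (α (k + 1) , β k).  In the first cycle the k-th even cell
-- gets k + 1 and the k-th odd cell 2n − k; in the second, 4n − k and 2n + 1 + k.  These four
-- blocks partition {1, …, 4n}.  Column β k meets exactly the k-th even and odd cells of a cycle,
-- whose labels add up to 2n + 1, resp. 6n + 1.  Row α (k + 1) meets the (k + 1)-th even and the
-- k-th odd cell, adding up to 2n + 2, resp. 6n, except in the row α 0 where the wrap-around
-- gives n + 2, resp. 7n.  Rotating the second traversal so that both start in the same row makes
-- the exceptional rows coincide, and then every row sums to 8n + 2 as well.
module Submission where

open import Defs
open import Data.Nat using (ℕ; zero; suc; _+_; _*_; _≤_; _<_; z≤n; s≤s; _%_)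
open import Data.Nat.Properties
  using (+-identityʳ; +-comm; +-cancelʳ-≡; m+[n∸m]≡n; m≤n⇒m<n∨m≡n; 1+n≰n; 0≢1+n;
         suc-injective; ≤-reflexive; <-trans; <-irrefl; n<1+n; +-0-commutativeMonoid)
open import Data.Nat.DivMod using (m<n⇒m%n≡m; n%n≡0; m%n<n)
open import Data.Nat.Tactic.RingSolver using (solve-∀)
open import Data.Fin using (Fin; toℕ; fromℕ<; punchIn; punchOut; opposite; combine)
open import Data.Fin.Patterns using (0F; 1F; 2F; 3F)
open import Data.Fin.Properties
  using (toℕ-injective; toℕ<n; toℕ-fromℕ<; any?; punchOut-injective; injective⇒≤; punchInᵢ≢i;
         punchIn-punchOut; punchIn-injective; opposite-prop; opposite-involutive; toℕ-combine;
         combine-injective; combine-surjective)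
  renaming (_≟_ to _≟ᶠ_)
open import Data.Bool using (Bool; true; false; if_then_else_)
open import Data.Bool.Properties using (∨-zeroʳ)
open import Data.Product using (Σ; ∃; ∃₂; _×_; _,_; proj₁; proj₂; uncurry)
open import Data.Product.Properties using (×-≡,≡→≡; ×-≡,≡←≡)
open import Data.Sum using (_⊎_; inj₁; inj₂)
open import Data.Empty using (⊥-elim)
open import Data.Vec.Functional using (removeAt)
open import Function using (id; _∘_)
open import Function.Definitions using (Injective; StrictlySurjective)
open import Relation.Nullary using (yes; no; does)
open import Relation.Nullary.Decidable using (dec-true; dec-false)
open import Relation.Binary.PropositionalEquality
open import Algebra.Properties.CommutativeMonoid.Sum +-0-commutativeMonoid
  using (sum-remove; sum-cong-≗; sum-replicate-zero; ∑-distrib-+)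

open ≡-Reasoning

injective⇒strictlySurjective : ∀ {n} {f : Fin n → Fin n} →
  Injective _≡_ _≡_ f → StrictlySurjective _≡_ f
injective⇒strictlySurjective {suc n} {f} f-injective y with any? (λ x → f x ≟ᶠ y)
... | yes hit = hit
... | no miss = ⊥-elim (1+n≰n (injective⇒≤ {f = g} g-injective))
  where
    g : Fin (suc n) → Fin n
    g x = punchOut {i = y} {j = f x} (λ e → miss (x , sym e))
    g-injective : Injective _≡_ _≡_ g
    g-injective {x} {x′} e =
      f-injective (punchOut-injective (λ e′ → miss (x , sym e′)) (λ e′ → miss (x′ , sym e′)) e)

sum-single : ∀ {n} (f : Fin n → ℕ) (p : Fin n) → (∀ j → j ≢ p → f j ≡ 0) → sumFin f ≡ f p
sum-single {suc n} f p vanishes = begin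
  sumFin f                     ≡⟨ sum-remove f ⟩
  f p + sumFin (removeAt f p)  ≡⟨ cong (f p +_) (sum-cong-≗ {x = removeAt f p} {y = λ _ → 0}
                                                   (λ j → vanishes _ (punchInᵢ≢i p j))) ⟩
  f p + sumFin {n} (λ _ → 0)   ≡⟨ cong (f p +_) (sum-replicate-zero n) ⟩
  f p + 0                      ≡⟨ +-identityʳ (f p) ⟩
  f p                          ∎

sum-pair : ∀ {n} (f : Fin n → ℕ) {p q : Fin n} → p ≢ q →
           (∀ j → j ≢ p → j ≢ q → f j ≡ 0) → sumFin f ≡ f p + f q
sum-pair {suc n} f {p} {q} p≢q vanishes = begin
  sumFin f                     ≡⟨ sum-remove f ⟩
  f p + sumFin (removeAt f p)  ≡⟨ cong (f p +_) (sum-single (removeAt f p) q′ vanishes′) ⟩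
  f p + f (punchIn p q′)       ≡⟨ cong (λ j → f p + f j) (punchIn-punchOut p≢q) ⟩
  f p + f q                    ∎
  where
    q′ : Fin n
    q′ = punchOut p≢q
    vanishes′ : ∀ j → j ≢ q′ → f (punchIn p j) ≡ 0
    vanishes′ j j≢q′ = vanishes _ (punchInᵢ≢i p j)
      (λ e → j≢q′ (punchIn-injective p j q′ (trans e (sym (punchIn-punchOut p≢q)))))

sum-mask-pair : ∀ {n} (s : Fin n → Bool) (f : Fin n → ℕ) {p q : Fin n} → p ≢ q →
                s p ≡ true → s q ≡ true → (∀ j → s j ≡ true → j ≡ p ⊎ j ≡ q) →
                sumFin (λ j → if s j then f j else 0) ≡ f p + f q
sum-mask-pair s f {p} {q} p≢q sp sq support = begin
  sumFin masked           ≡⟨ sum-pair masked p≢q vanishes ⟩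
  masked p + masked q     ≡⟨ cong₂ _+_ (unmask sp) (unmask sq) ⟩
  f p + f q               ∎
  where
    masked : Fin _ → ℕ
    masked j = if s j then f j else 0
    unmask : ∀ {j} → s j ≡ true → masked j ≡ f j
    unmask e = cong (λ b → if b then _ else 0) e
    vanishes : ∀ j → j ≢ p → j ≢ q → masked j ≡ 0
    vanishes j j≢p j≢q with s j in e
    ... | false = refl
    ... | true with support j e
    ...   | inj₁ j≡p = ⊥-elim (j≢p j≡p)
    ...   | inj₂ j≡q = ⊥-elim (j≢q j≡q)

sum-split : ∀ {n} (h f g : Fin n → ℕ) → (∀ j → h j ≡ f j + g j) → sumFin h ≡ sumFin f + sumFin g
sum-split h f g h≗f+g = trans (sum-cong-≗ {x = h} {y = λ j → f j + g j} h≗f+g) (∑-distrib-+ f g)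

suc%-cases : ∀ a n → a < suc n → suc a % suc n ≡ suc a ⊎ (suc a % suc n ≡ 0 × suc a ≡ suc n)
suc%-cases a n a<n with m≤n⇒m<n∨m≡n a<n
... | inj₁ 1+a<n = inj₁ (m<n⇒m%n≡m 1+a<n)
... | inj₂ refl  = inj₂ (n%n≡0 (suc n) , refl)

toℕ-sucMod : ∀ {n} (k : Fin n) →
             toℕ (sucMod k) ≡ suc (toℕ k) ⊎ (toℕ (sucMod k) ≡ 0 × suc (toℕ k) ≡ n)
toℕ-sucMod {suc n} k rewrite toℕ-fromℕ< (m%n<n (suc (toℕ k)) (suc n)) =
  suc%-cases (toℕ k) n (toℕ<n k)

sucMod-injective : ∀ {n} → Injective _≡_ _≡_ (sucMod {n})
sucMod-injective {n} {a} {b} e with toℕ-sucMod a | toℕ-sucMod b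
... | inj₁ a⁺ | inj₁ b⁺ = toℕ-injective (suc-injective (trans (sym a⁺) (trans (cong toℕ e) b⁺)))
... | inj₁ a⁺ | inj₂ (b⁰ , _) = ⊥-elim (0≢1+n (trans (sym b⁰) (trans (cong toℕ (sym e)) a⁺)))
... | inj₂ (a⁰ , _) | inj₁ b⁺ = ⊥-elim (0≢1+n (trans (sym a⁰) (trans (cong toℕ e) b⁺)))
... | inj₂ (_ , a-last) | inj₂ (_ , b-last) =
  toℕ-injective (suc-injective (trans a-last (sym b-last)))

sucMod-irreflexive : ∀ {n} → 2 ≤ n → (k : Fin n) → sucMod k ≢ k
sucMod-irreflexive 2≤n k e with toℕ-sucMod k
... | inj₁ k⁺ = 1+n≰n (≤-reflexive (trans (sym k⁺) (cong toℕ e)))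
sucMod-irreflexive (s≤s (s≤s _)) k e | inj₂ (k⁰ , k-last) =
  0≢1+n (trans (sym (trans (sym (cong toℕ e)) k⁰)) (suc-injective k-last))

rotate : ∀ {n} → ℕ → Fin n → Fin n
rotate zero    = id
rotate (suc r) = sucMod ∘ rotate r

rotate-injective : ∀ {n} r → Injective _≡_ _≡_ (rotate {n} r)
rotate-injective zero    e = e
rotate-injective (suc r) e = rotate-injective r (sucMod-injective e)

rotate-sucMod : ∀ {n} r (k : Fin n) → rotate r (sucMod k) ≡ sucMod (rotate r k)
rotate-sucMod zero    k = refl
rotate-sucMod (suc r) k = cong sucMod (rotate-sucMod r k)

toℕ-rotate-0 : ∀ {n} r → r < suc n → toℕ (rotate {suc n} r 0F) ≡ r
toℕ-rotate-0 zero    _   = refl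
toℕ-rotate-0 (suc r) 1+r<n with toℕ-sucMod (rotate r 0F) | toℕ-rotate-0 r (<-trans (n<1+n r) 1+r<n)
... | inj₁ e           | ih = trans e (cong suc ih)
... | inj₂ (_ , last) | ih = ⊥-elim (<-irrefl (trans (cong suc (sym ih)) last) 1+r<n)

rowOrdering : ∀ {n} {S : Cells n} → IsHamiltonCycle S → Fin n → Fin n
rowOrdering (_ , α , _) = α

startingAt : ∀ {n} {S : Cells (suc n)} → IsHamiltonCycle S → (a : Fin (suc n)) →
             Σ (IsHamiltonCycle S) λ h → rowOrdering h 0F ≡ a
startingAt {n} {S} (2≤n , α , β , α-injective , β-injective , covered , on-cycle) a =
  (2≤n , α ∘ ρ , β ∘ ρ , α-injective′ , β-injective′ , covered′ , on-cycle′) , starts-at-a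
  where
    z : Fin (suc n)
    z = proj₁ (injective⇒strictlySurjective α-injective a)
    ρ : Fin (suc n) → Fin (suc n)
    ρ = rotate (toℕ z)
    α-injective′ : Injective _≡_ _≡_ (α ∘ ρ)
    α-injective′ e = rotate-injective (toℕ z) (α-injective e)
    β-injective′ : Injective _≡_ _≡_ (β ∘ ρ)
    β-injective′ e = rotate-injective (toℕ z) (β-injective e)
    covered′ : ∀ i j → S i j ≡ true →
               ∃ λ k → (i ≡ α (ρ k) × j ≡ β (ρ k)) ⊎ (i ≡ α (ρ (sucMod k)) × j ≡ β (ρ k))
    covered′ i j s with covered i j s
    ... | k₀ , on-k₀ with injective⇒strictlySurjective (rotate-injective (toℕ z)) k₀
    ... | k , refl with on-k₀
    ...   | inj₁ at-k      = k , inj₁ at-k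
    ...   | inj₂ (i≡ , j≡) = k , inj₂ (trans i≡ (cong α (sym (rotate-sucMod (toℕ z) k))) , j≡)
    on-cycle′ : ∀ k → S (α (ρ k)) (β (ρ k)) ≡ true × S (α (ρ (sucMod k))) (β (ρ k)) ≡ true
    on-cycle′ k = proj₁ (on-cycle (ρ k)) ,
      subst (λ k′ → S (α k′) (β (ρ k)) ≡ true) (sym (rotate-sucMod (toℕ z) k))
            (proj₂ (on-cycle (ρ k)))
    starts-at-a : α (ρ 0F) ≡ a
    starts-at-a = trans (cong α (toℕ-injective (toℕ-rotate-0 (toℕ z) (toℕ<n z))))
                        (proj₂ (injective⇒strictlySurjective α-injective a))

module HamiltonCycle {n} {S : Cells n} (h : IsHamiltonCycle S) where

  2≤n : 2 ≤ n
  2≤n = let (2≤n , _) = h in 2≤n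

  α β : Fin n → Fin n
  α = let (_ , α , _) = h in α
  β = let (_ , _ , β , _) = h in β

  α-injective : Injective _≡_ _≡_ α
  α-injective = let (_ , _ , _ , α-injective , _) = h in α-injective

  β-injective : Injective _≡_ _≡_ β
  β-injective = let (_ , _ , _ , _ , β-injective , _) = h in β-injective

  row : Bool → Fin n → Fin n
  row true  k = α k
  row false k = α (sucMod k)

  edge : Bool → Fin n → Fin n × Fin n
  edge p k = row p k , β k

  covered : ∀ i j → S i j ≡ true →
            ∃ λ k → (i ≡ α k × j ≡ β k) ⊎ (i ≡ α (sucMod k) × j ≡ β k)
  covered = let (_ , _ , _ , _ , _ , covered , _) = h in covered

  on-cycle : ∀ k → S (α k) (β k) ≡ true × S (α (sucMod k)) (β k) ≡ true
  on-cycle = let (_ , _ , _ , _ , _ , _ , on-cycle) = h in on-cycle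

  edge-on-cycle : ∀ p k → uncurry S (edge p k) ≡ true
  edge-on-cycle true  k = proj₁ (on-cycle k)
  edge-on-cycle false k = proj₂ (on-cycle k)

  cell-is-edge : ∀ i j → S i j ≡ true → ∃₂ λ p k → row p k ≡ i × β k ≡ j
  cell-is-edge i j s with covered i j s
  ... | k , inj₁ (i≡ , j≡) = true  , k , sym i≡ , sym j≡
  ... | k , inj₂ (i≡ , j≡) = false , k , sym i≡ , sym j≡

  α-sucMod-distinct : ∀ k → α k ≢ α (sucMod k)
  α-sucMod-distinct k e = sucMod-irreflexive 2≤n k (sym (α-injective e))

  column-support : ∀ k {i} → S i (β k) ≡ true → i ≡ α k ⊎ i ≡ α (sucMod k)
  column-support k {i} s with cell-is-edge i (β k) s
  ... | true  , k′ , refl , βk′≡βk = inj₁ (cong α (β-injective βk′≡βk))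
  ... | false , k′ , refl , βk′≡βk = inj₂ (cong (α ∘ sucMod) (β-injective βk′≡βk))

  row-support : ∀ k {j} → S (α (sucMod k)) j ≡ true → j ≡ β (sucMod k) ⊎ j ≡ β k
  row-support k {j} s with cell-is-edge (α (sucMod k)) j s
  ... | true  , k′ , αk′≡ , refl = inj₁ (cong β (α-injective αk′≡))
  ... | false , k′ , αk′≡ , refl = inj₂ (cong β (sucMod-injective (α-injective αk′≡)))

  β⁻¹ : Fin n → Fin n
  β⁻¹ j = proj₁ (injective⇒strictlySurjective β-injective j)

  β⁻¹-β : ∀ k → β⁻¹ (β k) ≡ k
  β⁻¹-β k = β-injective (proj₂ (injective⇒strictlySurjective β-injective (β k)))

  label : (Bool → Fin n → ℕ) → Fin n → Fin n → ℕ
  label ℓ i j = ℓ (does (i ≟ᶠ α (β⁻¹ j))) (β⁻¹ j)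

  label-edge : ∀ ℓ p k → uncurry (label ℓ) (edge p k) ≡ ℓ p k
  label-edge ℓ p k rewrite β⁻¹-β k = cong (λ b → ℓ b k) (parity p)
    where
      parity : ∀ p → does (row p k ≟ᶠ α k) ≡ p
      parity true  = dec-true (α k ≟ᶠ α k) refl
      parity false = dec-false (α (sucMod k) ≟ᶠ α k) (α-sucMod-distinct k ∘ sym)

  column-sum-at : ∀ ℓ k → sumFin (λ i → entry S (label ℓ) i (β k)) ≡ ℓ true k + ℓ false k
  column-sum-at ℓ k = begin
    sumFin (λ i → entry S (label ℓ) i (β k))
      ≡⟨ sum-mask-pair (λ i → S i (β k)) (λ i → label ℓ i (β k)) (α-sucMod-distinct k)
           (edge-on-cycle true k) (edge-on-cycle false k) (λ i → column-support k) ⟩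
    label ℓ (α k) (β k) + label ℓ (α (sucMod k)) (β k)
      ≡⟨ cong₂ _+_ (label-edge ℓ true k) (label-edge ℓ false k) ⟩
    ℓ true k + ℓ false k ∎

  column-sum : ∀ ℓ j → ∃ λ k → sumFin (λ i → entry S (label ℓ) i j) ≡ ℓ true k + ℓ false k
  column-sum ℓ j = let (k , βk≡j) = injective⇒strictlySurjective β-injective j in
    k , subst (λ j → sumFin (λ i → entry S (label ℓ) i j) ≡ ℓ true k + ℓ false k)
              βk≡j (column-sum-at ℓ k)

  row-sum : ∀ ℓ i → ∃ λ k → α (sucMod k) ≡ i ×
            sumFin (λ j → entry S (label ℓ) i j) ≡ ℓ true (sucMod k) + ℓ false k
  row-sum ℓ i with injective⇒strictlySurjective (sucMod-injective ∘ α-injective) i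
  ... | k , refl = k , refl , (begin
    sumFin (λ j → entry S (label ℓ) (α (sucMod k)) j)
      ≡⟨ sum-mask-pair (S (α (sucMod k))) (label ℓ (α (sucMod k)))
           (sucMod-irreflexive 2≤n k ∘ β-injective)
           (edge-on-cycle true (sucMod k)) (edge-on-cycle false k) (λ j → row-support k) ⟩
    label ℓ (α (sucMod k)) (β (sucMod k)) + label ℓ (α (sucMod k)) (β k)
      ≡⟨ cong₂ _+_ (label-edge ℓ true (sucMod k)) (label-edge ℓ false k) ⟩
    ℓ true (sucMod k) + ℓ false k ∎)

value : ∀ {k n} → Fin k → Fin n → ℕ
value q r = suc (toℕ (combine q r))

value-toℕ : ∀ {k n} (q : Fin k) (r : Fin n) → value q r ≡ suc (n * toℕ q + toℕ r)
value-toℕ q r = cong suc (toℕ-combine q r)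

value-bounds : ∀ {k n} (t : Fin k × Fin n) → 1 ≤ uncurry value t × uncurry value t ≤ k * n
value-bounds (q , r) = s≤s z≤n , toℕ<n (combine q r)

value-injective : ∀ {k n} → Injective _≡_ _≡_ (uncurry (value {k} {n}))
value-injective {x = q , r} {y = q′ , r′} e =
  ×-≡,≡→≡ (combine-injective q r q′ r′ (toℕ-injective (suc-injective e)))

value-onto : ∀ {k n} v → 1 ≤ v → v ≤ k * n → ∃ λ t → uncurry (value {k} {n}) t ≡ v
value-onto (suc u) _ u<kn with combine-surjective (fromℕ< u<kn)
... | q , r , combine≡ = (q , r) , cong suc (trans (cong toℕ combine≡) (toℕ-fromℕ< u<kn))

toℕ+toℕ-opposite : ∀ {n} (r : Fin n) → suc (toℕ r + toℕ (opposite r)) ≡ n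
toℕ+toℕ-opposite r = trans (cong (suc (toℕ r) +_) (opposite-prop r)) (m+[n∸m]≡n (toℕ<n r))

-- value q r = q n + r + 1 and toℕ (opposite r) = n − 1 − r, so these are the labels k + 1,
-- 2n − k of the first cycle and 4n − k, 2n + 1 + k of the second.
labels₁ labels₂ : ∀ {n} → Bool → Fin n → ℕ
labels₁ true  k = value {4} 0F k
labels₁ false k = value {4} 1F (opposite k)
labels₂ true  k = value {4} 3F (opposite k)
labels₂ false k = value {4} 2F k

-- Adding xc + xb to both sides avoids truncated subtraction.
balanced-sum : ∀ n xa xb xc xd ob oc →
  suc (xb + ob) ≡ n → suc (xc + oc) ≡ n → xa + xd ≡ xc + xb →
  (suc (n * 0 + xa) + suc (n * 1 + ob)) + (suc (n * 3 + oc) + suc (n * 2 + xd)) ≡ 8 * n + 2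
balanced-sum n xa xb xc xd ob oc b-span c-span balanced = +-cancelʳ-≡ (xc + xb) _ _ (begin
  (suc (n * 0 + xa) + suc (n * 1 + ob)) + (suc (n * 3 + oc) + suc (n * 2 + xd)) + (xc + xb)
    ≡⟨ regroup n xa xb xc xd ob oc ⟩
  (xa + xd) + suc (xb + ob) + suc (xc + oc) + (6 * n + 2)
    ≡⟨ cong₂ (λ s t → s + t + (6 * n + 2)) (cong₂ _+_ balanced b-span) c-span ⟩
  (xc + xb) + n + n + (6 * n + 2)
    ≡⟨ collect n (xc + xb) ⟩
  8 * n + 2 + (xc + xb) ∎)
  where
    regroup : ∀ n xa xb xc xd ob oc →
      (suc (n * 0 + xa) + suc (n * 1 + ob)) + (suc (n * 3 + oc) + suc (n * 2 + xd)) + (xc + xb)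
        ≡ (xa + xd) + suc (xb + ob) + suc (xc + oc) + (6 * n + 2)
    regroup = solve-∀
    collect : ∀ n x → x + n + n + (6 * n + 2) ≡ 8 * n + 2 + x
    collect = solve-∀

-- The four label families have slopes 1, −1, −1, 1 in the position.
labels-balanced : ∀ {n} (a b c d : Fin n) → toℕ a + toℕ d ≡ toℕ c + toℕ b →
  (labels₁ true a + labels₁ false b) + (labels₂ true c + labels₂ false d) ≡ 8 * n + 2
labels-balanced {n} a b c d balanced = begin
  (labels₁ true a + labels₁ false b) + (labels₂ true c + labels₂ false d)
    ≡⟨ cong₂ _+_ (cong₂ _+_ (value-toℕ {4} 0F a) (value-toℕ {4} 1F (opposite b)))
                 (cong₂ _+_ (value-toℕ {4} 3F (opposite c)) (value-toℕ {4} 2F d)) ⟩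
  (suc (n * 0 + toℕ a) + suc (n * 1 + toℕ (opposite b)))
    + (suc (n * 3 + toℕ (opposite c)) + suc (n * 2 + toℕ d))
    ≡⟨ balanced-sum n (toℕ a) (toℕ b) (toℕ c) (toℕ d) (toℕ (opposite b)) (toℕ (opposite c))
         (toℕ+toℕ-opposite b) (toℕ+toℕ-opposite c) balanced ⟩
  8 * n + 2 ∎

isFilling-byTags : ∀ {n m} {Tag : Set} {U : Cells n} {L : Fin n → Fin n → ℕ}
  (cell : Tag → Fin n × Fin n) (val : Tag → ℕ) →
  (∀ t → uncurry U (cell t) ≡ true) →
  (∀ i j → U i j ≡ true → ∃ λ t → cell t ≡ (i , j)) →
  (∀ t → uncurry L (cell t) ≡ val t) →
  (∀ t → 1 ≤ val t × val t ≤ m) →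
  Injective _≡_ _≡_ val →
  (∀ v → 1 ≤ v → v ≤ m → ∃ λ t → val t ≡ v) →
  IsFilling m U L
isFilling-byTags {m = m} {U = U} {L = L}
                 cell val cell-in-U cover L-cell val-bounds val-injective val-onto =
  bounds , injective , onto
  where
    bounds : ∀ i j → U i j ≡ true → 1 ≤ L i j × L i j ≤ m
    bounds i j u with cover i j u
    ... | t , refl = subst (λ x → 1 ≤ x × x ≤ m) (sym (L-cell t)) (val-bounds t)
    injective : ∀ i j i′ j′ → U i j ≡ true → U i′ j′ ≡ true → L i j ≡ L i′ j′ → i ≡ i′ × j ≡ j′
    injective i j i′ j′ u u′ e with cover i j u | cover i′ j′ u′
    ... | t , refl | t′ , refl =
      ×-≡,≡←≡ (cong cell (val-injective (trans (sym (L-cell t)) (trans e (L-cell t′)))))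
    onto : ∀ v → 1 ≤ v → v ≤ m → ∃ λ i → ∃ λ j → U i j ≡ true × L i j ≡ v
    onto v 1≤v v≤m with val-onto v 1≤v v≤m
    ... | t , refl = proj₁ (cell t) , proj₂ (cell t) , cell-in-U t , L-cell t

module TwoCycles {n} {S₁ S₂ : Cells (suc n)} (h₁ : IsHamiltonCycle S₁) (h₂ : IsHamiltonCycle S₂)
  (same-start : rowOrdering h₁ 0F ≡ rowOrdering h₂ 0F) (disjoint : Disjoint S₁ S₂) where

  module C₁ = HamiltonCycle h₁
  module C₂ = HamiltonCycle h₂

  U : Cells (suc n)
  U = Union S₁ S₂

  L₁ L₂ L : Fin (suc n) → Fin (suc n) → ℕ
  L₁ = C₁.label labels₁
  L₂ = C₂.label labels₂
  L i j = if S₁ i j then L₁ i j else L₂ i j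

  S₂⇒¬S₁ : ∀ {i j} → S₂ i j ≡ true → S₁ i j ≡ false
  S₂⇒¬S₁ {i} {j} s₂ with S₁ i j in s₁
  ... | false = refl
  ... | true with () ← trans (sym s₂) (disjoint i j s₁)

  L-on-S₁ : ∀ {i j} → S₁ i j ≡ true → L i j ≡ L₁ i j
  L-on-S₁ {i} {j} s₁ = cong (λ b → if b then L₁ i j else L₂ i j) s₁

  L-on-S₂ : ∀ {i j} → S₂ i j ≡ true → L i j ≡ L₂ i j
  L-on-S₂ {i} {j} s₂ = cong (λ b → if b then L₁ i j else L₂ i j) (S₂⇒¬S₁ s₂)

  U-on-S₁ : ∀ {i j} → S₁ i j ≡ true → U i j ≡ true
  U-on-S₁ s₁ rewrite s₁ = refl

  U-on-S₂ : ∀ {i j} → S₂ i j ≡ true → U i j ≡ true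
  U-on-S₂ {i} {j} s₂ rewrite s₂ = ∨-zeroʳ (S₁ i j)

  cell : Fin 4 × Fin (suc n) → Fin (suc n) × Fin (suc n)
  cell (0F , r) = C₁.edge true r
  cell (1F , r) = C₁.edge false (opposite r)
  cell (2F , r) = C₂.edge false r
  cell (3F , r) = C₂.edge true (opposite r)

  cell-in-U : ∀ t → uncurry U (cell t) ≡ true
  cell-in-U (0F , r) = U-on-S₁ (C₁.edge-on-cycle true r)
  cell-in-U (1F , r) = U-on-S₁ (C₁.edge-on-cycle false (opposite r))
  cell-in-U (2F , r) = U-on-S₂ (C₂.edge-on-cycle false r)
  cell-in-U (3F , r) = U-on-S₂ (C₂.edge-on-cycle true (opposite r))

  L-cell : ∀ t → uncurry L (cell t) ≡ uncurry value t
  L-cell (0F , r) = trans (L-on-S₁ (C₁.edge-on-cycle true r)) (C₁.label-edge labels₁ true r)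
  L-cell (1F , r) = trans (L-on-S₁ (C₁.edge-on-cycle false (opposite r)))
    (trans (C₁.label-edge labels₁ false (opposite r)) (cong (value {4} 1F) (opposite-involutive r)))
  L-cell (2F , r) = trans (L-on-S₂ (C₂.edge-on-cycle false r)) (C₂.label-edge labels₂ false r)
  L-cell (3F , r) = trans (L-on-S₂ (C₂.edge-on-cycle true (opposite r)))
    (trans (C₂.label-edge labels₂ true (opposite r)) (cong (value {4} 3F) (opposite-involutive r)))

  cell-cover : ∀ i j → U i j ≡ true → ∃ λ t → cell t ≡ (i , j)
  cell-cover i j u with S₁ i j in s₁
  cell-cover i j u | true with C₁.cell-is-edge i j s₁
  ... | true  , k , refl , refl = (0F , k) , refl
  ... | false , k , refl , refl = (1F , opposite k) , cong (C₁.edge false) (opposite-involutive k)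
  cell-cover i j u | false with C₂.cell-is-edge i j u
  ... | true  , k , refl , refl = (3F , opposite k) , cong (C₂.edge true) (opposite-involutive k)
  ... | false , k , refl , refl = (2F , k) , refl

  isFilling : IsFilling (4 * suc n) U L
  isFilling = isFilling-byTags cell (uncurry value) cell-in-U cell-cover L-cell
                value-bounds value-injective value-onto

  entry-split : ∀ i j → entry U L i j ≡ entry S₁ L₁ i j + entry S₂ L₂ i j
  entry-split i j with S₁ i j in s₁ | S₂ i j in s₂
  ... | true  | true  with () ← trans (sym s₂) (disjoint i j s₁)
  ... | true  | false = sym (+-identityʳ (L₁ i j))
  ... | false | true  = refl
  ... | false | false = refl

  start-row₁ : ∀ {k₁ k₂} → C₁.α k₁ ≡ C₂.α k₂ → k₂ ≡ 0F → k₁ ≡ 0F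
  start-row₁ e refl = C₁.α-injective (trans e (sym same-start))

  start-row₂ : ∀ {k₁ k₂} → C₁.α k₁ ≡ C₂.α k₂ → k₁ ≡ 0F → k₂ ≡ 0F
  start-row₂ e refl = C₂.α-injective (trans (sym e) same-start)

  -- Both traversals start in the same row, so a row is the wrap-around row of both or of neither.
  aligned : ∀ k₁ k₂ → C₁.α (sucMod k₁) ≡ C₂.α (sucMod k₂) →
            toℕ (sucMod k₁) + toℕ k₂ ≡ toℕ (sucMod k₂) + toℕ k₁
  aligned k₁ k₂ same-row with toℕ-sucMod k₁ | toℕ-sucMod k₂
  ... | inj₁ e₁ | inj₁ e₂ = begin
    toℕ (sucMod k₁) + toℕ k₂  ≡⟨ cong (_+ toℕ k₂) e₁ ⟩
    suc (toℕ k₁ + toℕ k₂)     ≡⟨ cong suc (+-comm (toℕ k₁) (toℕ k₂)) ⟩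
    suc (toℕ k₂ + toℕ k₁)     ≡⟨ cong (_+ toℕ k₁) e₂ ⟨
    toℕ (sucMod k₂) + toℕ k₁  ∎
  ... | inj₂ (z₁ , last₁) | inj₂ (z₂ , last₂) =
    cong₂ _+_ (trans z₁ (sym z₂)) (suc-injective (trans last₂ (sym last₁)))
  ... | inj₁ e₁ | inj₂ (z₂ , _) =
    ⊥-elim (0≢1+n (trans (sym (cong toℕ (start-row₁ same-row (toℕ-injective z₂)))) e₁))
  ... | inj₂ (z₁ , _) | inj₁ e₂ =
    ⊥-elim (0≢1+n (trans (sym (cong toℕ (start-row₂ same-row (toℕ-injective z₁)))) e₂))

  row-sums : ∀ i → sumFin (λ j → entry U L i j) ≡ 8 * suc n + 2
  row-sums i with C₁.row-sum labels₁ i | C₂.row-sum labels₂ i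
  ... | k₁ , row₁ , sum₁ | k₂ , row₂ , sum₂ = begin
    sumFin (λ j → entry U L i j)
      ≡⟨ sum-split _ (entry S₁ L₁ i) (entry S₂ L₂ i) (entry-split i) ⟩
    sumFin (λ j → entry S₁ L₁ i j) + sumFin (λ j → entry S₂ L₂ i j)
      ≡⟨ cong₂ _+_ sum₁ sum₂ ⟩
    (labels₁ true (sucMod k₁) + labels₁ false k₁) + (labels₂ true (sucMod k₂) + labels₂ false k₂)
      ≡⟨ labels-balanced (sucMod k₁) k₁ (sucMod k₂) k₂ (aligned k₁ k₂ (trans row₁ (sym row₂))) ⟩
    8 * suc n + 2 ∎

  column-sums : ∀ j → sumFin (λ i → entry U L i j) ≡ 8 * suc n + 2
  column-sums j with C₁.column-sum labels₁ j | C₂.column-sum labels₂ j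
  ... | k₁ , sum₁ | k₂ , sum₂ = begin
    sumFin (λ i → entry U L i j)
      ≡⟨ sum-split _ (λ i → entry S₁ L₁ i j) (λ i → entry S₂ L₂ i j) (λ i → entry-split i j) ⟩
    sumFin (λ i → entry S₁ L₁ i j) + sumFin (λ i → entry S₂ L₂ i j)
      ≡⟨ cong₂ _+_ sum₁ sum₂ ⟩
    (labels₁ true k₁ + labels₁ false k₁) + (labels₂ true k₂ + labels₂ false k₂)
      ≡⟨ labels-balanced k₁ k₁ k₂ k₂ (+-comm (toℕ k₁) (toℕ k₂)) ⟩
    8 * suc n + 2 ∎

lemma2p1 : (n : ℕ) (S₁ S₂ : Cells n) →
    IsHamiltonCycle S₁ → IsHamiltonCycle S₂ → Disjoint S₁ S₂ →
    Σ (Fin n → Fin n → ℕ) λ L →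
      IsFilling (4 * n) (Union S₁ S₂) L ×
      (∀ i → sumFin (λ j → entry (Union S₁ S₂) L i j) ≡ 8 * n + 2) ×
      (∀ j → sumFin (λ i → entry (Union S₁ S₂) L i j) ≡ 8 * n + 2)
lemma2p1 zero    _  _  (() , _) _ _
lemma2p1 (suc n) S₁ S₂ h₁ h₂ disjoint with startingAt h₂ (rowOrdering h₁ 0F)
... | h₂′ , same-start = L , isFilling , row-sums , column-sums
  where open TwoCycles h₁ h₂′ (sym same-start) disjoint
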